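{- Let $A$ be a setoid, $B$ a setoid family over $A$ and $(C,a_C)$ a $P_B$-algebra. For every $w:W$ there are $\mathsf{recImS}\,w:\mathsf{ImS}\,w\Rightarrow C$ and a term $\mathsf{recImSpf}\,w:\mathsf{RecDef}\,w\,(\mathsf{recImS}\,w)$.
   Context: Setting: intensional Martin-Löf type theory with $\Pi$-types and a universe $\mathsf{U}$ closed under $\Pi$ and containing intensional $\Sigma$-types, identity types, the unit type, W-types and dependent W-types (inductive families); logic is propositions-as-types. A setoid $X$ is a tuple $(X_0,\approx_X,r_X,s_X,t_X)$ with $X_0:\mathsf{U}$, $\approx_X:X_0\to X_0\to\mathsf{U}$ and witnesses of reflexivity, symmetry, transitivity; $x:X$ means $x:X_0$. An extensional function $f:X\Rightarrow Y$ is $f_0:X_0\to Y_0$ with a proof of $\prod_{x,x'}x\approx x'\to f_0x\approx f_0x'$; the setoid $X\Rightarrow Y$ has $f\approx g:=\prod_x f_0x\approx g_0x$. A setoid family $B$ over a setoid $A$ gives a setoid $B\,a$ (underlying type $B_0a$) for $a:A$ and extensional transports $B_\alpha:B\,a\Rightarrow B\,a'$ for $\alpha:a\approx_Aa'$, functorial up to $\approx$, with $B_\alpha\approx B_{\alpha'}$ for all $\alpha,\alpha':a\approx a'$. Write $b\approx_\alpha b'$ for $B_\alpha b\approx b'$. $P_BX$ is the setoid on $\sum_{a:A_0}(B\,a\Rightarrow X)$ with $(a,k)\approx(a',k'):=\sum_{\alpha:a\approx a'}k\approx k'\circ B_\alpha$. A $P_B$-algebra is a setoid $C$ with extensional $a_C:P_BC\Rightarrow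 C$. $\mathrm{W}$ is the W-type on $A_0,B_0$ with constructor $\mathsf{sup}$, and $\mathsf{n}(\mathsf{sup}\,a\,f)\equiv a$, $\mathsf{b}(\mathsf{sup}\,a\,f)\equiv f$. $\mathcal{W}_B$ is the inductive family on $\mathrm{W}\times\mathrm{W}$ with single constructor $\mathsf{dsup}\,(w,w')\,\alpha\,\phi:\mathcal{W}_B\,w\,w'$ for $\alpha:\mathsf{n}w\approx_A\mathsf{n}w'$ and $\phi:\prod_{(b,b',\beta):\sum_{b,b'}b\approx_\alpha b'}\mathcal{W}_B(\mathsf{b}\,w\,b)(\mathsf{b}\,w'\,b')$. The setoid $W$ has underlying type $\sum_w\mathcal{W}_B\,w\,w$ and $(w,\_)\approx_W(w',\_):=\mathcal{W}_B\,w\,w'$. For $\gamma:w\approx_Ww'$, $\mathsf{n}\triangleright\gamma:\mathsf{n}w\approx_A\mathsf{n}w'$ is its label component; each $\mathsf{b}\,w:B(\mathsf{n}w)\Rightarrow W$ is extensional. For $w:W$, $\mathsf{ImS}\,w$ is the setoid on $B_0(\mathsf{n}w)$ with $s\approx s':=\mathsf{b}\,w\,s\approx_W\mathsf{b}\,w\,s'$; for $\gamma:w\approx_Ww'$, $\mathsf{ImS}_\gamma:=B_{\mathsf{n}\triangleright\gamma}$. $e_w:B(\mathsf{n}w)\Rightarrow\mathsf{ImS}\,w$ is the identity on underlying types. $\mathsf{CohMaps}\,w$ is the setoid of families $F:\prod_{s:\mathsf{ImS}\,w}\mathsf{ImS}(\mathsf{b}\,w\,s)\Rightarrow C$ such that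 $F\,s\approx(F\,s')\circ\mathsf{ImS}_\sigma$ for all $\sigma:\mathsf{b}\,w\,s\approx_W\mathsf{b}\,w\,s'$. For $F:\mathsf{CohMaps}\,w$, $\mathsf{recst}\,w\,F:\mathsf{ImS}\,w\Rightarrow C$ is $s\mapsto a_C(\mathsf{n}(\mathsf{b}\,w\,s),(F\,s)\circ e_{\mathsf{b}ws})$. For $k:\mathsf{ImS}\,w\Rightarrow C$, $\mathsf{RecDef}\,w\,k$ is the inductive family (dependent W-type indexed by $\sum_{w:W}(\mathsf{ImS}\,w\Rightarrow C)$) with the single constructor: from $F:\mathsf{CohMaps}\,w$, a proof of $k\approx\mathsf{recst}\,w\,F$ and $\prod_{s:B_0(\mathsf{n}w)}\mathsf{RecDef}\,(\mathsf{b}\,w\,s)\,(F\,s)$, form an element of $\mathsf{RecDef}\,w\,k$. -}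

module Defs where

open import Level using (0ℓ)
open import Relation.Binary.Bundles using (Setoid)
open import Function.Bundles using (Func)
open import Data.Product using (Σ; _,_; proj₁; proj₂)

open Func

-- Setoids live in Set (playing the role of the universe U); setoid
-- relations are proof-relevant (Set-valued), as in propositions-as-types.
-- Extensional functions X ⇒ Y are stdlib's Func X Y.

_≋_ : {X Y : Setoid 0ℓ 0ℓ} → Func X Y → Func X Y → Set
_≋_ {X} {Y} f g = (x : Setoid.Carrier X) → Setoid._≈_ Y (to f x) (to g x)

_∘F_ : {X Y Z : Setoid 0ℓ 0ℓ} → Func Y Z → Func X Y → Func X Z
g ∘F f = record { to = λ x → to g (to f x) ; cong = λ p → cong g (cong f p) }

idF : {X : Setoid 0ℓ 0ℓ} → Func X X
idF = record { to = λ x → x ; cong = λ p → p }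

_⇒S_ : Setoid 0ℓ 0ℓ → Setoid 0ℓ 0ℓ → Setoid 0ℓ 0ℓ
X ⇒S Y = record
  { Carrier = Func X Y
  ; _≈_ = _≋_
  ; isEquivalence = record
    { refl = λ x → Setoid.refl Y
    ; sym = λ p x → Setoid.sym Y (p x)
    ; trans = λ p q x → Setoid.trans Y (p x) (q x) } }

record SetoidFam (A : Setoid 0ℓ 0ℓ) : Set₁ where
  field
    Fib : Setoid.Carrier A → Setoid 0ℓ 0ℓ
    tr : {a a' : Setoid.Carrier A} → Setoid._≈_ A a a' → Func (Fib a) (Fib a')
    tr-refl : {a : Setoid.Carrier A} → tr (Setoid.refl A {a}) ≋ idF
    tr-trans : {a a' a'' : Setoid.Carrier A}
               (α : Setoid._≈_ A a a') (α' : Setoid._≈_ A a' a'') →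
               (tr α' ∘F tr α) ≋ tr (Setoid.trans A α α')
    tr-irr : {a a' : Setoid.Carrier A} (α α' : Setoid._≈_ A a a') → tr α ≋ tr α'

module WTypes {A : Setoid 0ℓ 0ℓ} (B : SetoidFam A) where
  open SetoidFam B
  private
    module A = Setoid A
    module F (a : A.Carrier) = Setoid (Fib a)

  B₀ : A.Carrier → Set
  B₀ a = Setoid.Carrier (Fib a)

  _≈[_]_ : {a a' : A.Carrier} → B₀ a → A._≈_ a a' → B₀ a' → Set
  _≈[_]_ {a} {a'} b α b' = F._≈_ a' (to (tr α) b) b'

  tr-id : {a : A.Carrier} (α : A._≈_ a a) (b : B₀ a) → b ≈[ α ] b
  tr-id {a} α b = F.trans a (tr-irr α A.refl b) (tr-refl b)

  tr-cancel : {a a' : A.Carrier} (α : A._≈_ a a') (x : B₀ a') →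
              F._≈_ a' (to (tr α) (to (tr (A.sym α)) x)) x
  tr-cancel {a} {a'} α x =
    F.trans a' (tr-trans (A.sym α) α x)
      (F.trans a' (tr-irr _ A.refl x) (tr-refl x))

  PB : Setoid 0ℓ 0ℓ → Setoid 0ℓ 0ℓ
  PB X = record
    { Carrier = Σ A.Carrier (λ a → Func (Fib a) X)
    ; _≈_ = λ p q → Σ (A._≈_ (proj₁ p) (proj₁ q))
                      (λ α → proj₂ p ≋ (proj₂ q ∘F tr α))
    ; isEquivalence = record
      { refl = λ {p} → A.refl , λ x → X.sym (cong (proj₂ p) (tr-refl x))
      ; sym = λ { {a , k} {a' , k'} (α , e) →
                   A.sym α , λ x → X.sym (X.trans (e _) (cong k' (tr-cancel α x))) }
      ; trans = λ { {a , k} {a' , k'} {a'' , k''} (α , e) (α' , e') →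
                     A.trans α α' , λ x →
                       X.trans (e x) (X.trans (e' _) (cong k'' (tr-trans α α' x))) }
      } }
    where module X = Setoid X

  data 𝕎 : Set where
    sup : (a : A.Carrier) → (B₀ a → 𝕎) → 𝕎

  n : 𝕎 → A.Carrier
  n (sup a f) = a

  br : (w : 𝕎) → B₀ (n w) → 𝕎
  br (sup a f) = f

  -- the inductive family 𝒲_B on 𝕎 × 𝕎
  -- (the paper's φ on Σ-triples (b , b' , β) is written curried)
  data 𝒲 : 𝕎 → 𝕎 → Set where
    dsup : {w w' : 𝕎} (α : A._≈_ (n w) (n w')) →
           ((b : B₀ (n w)) (b' : B₀ (n w')) → b ≈[ α ] b' →
              𝒲 (br w b) (br w' b')) →
           𝒲 w w'

  nlab : {w w' : 𝕎} → 𝒲 w w' → A._≈_ (n w) (n w')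
  nlab (dsup α φ) = α

  𝒲-sym : {w w' : 𝕎} → 𝒲 w w' → 𝒲 w' w
  𝒲-sym {w} {w'} (dsup α φ) =
    dsup (A.sym α) (λ b' b β →
      𝒲-sym (φ b b' (F.trans (n w') (cong (tr α) (F.sym (n w) β)) (tr-cancel α b'))))

  𝒲-trans : {w w' w'' : 𝕎} → 𝒲 w w' → 𝒲 w' w'' → 𝒲 w w''
  𝒲-trans {w} {w'} {w''} (dsup α φ) (dsup α' ψ) =
    dsup (A.trans α α') (λ b b'' β →
      𝒲-trans (φ b (to (tr α) b) (F.refl (n w')))
              (ψ (to (tr α) b) b'' (F.trans (n w'') (tr-trans α α' b) β)))

  W : Setoid 0ℓ 0ℓ
  W = record
    { Carrier = Σ 𝕎 (λ w → 𝒲 w w)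
    ; _≈_ = λ p q → 𝒲 (proj₁ p) (proj₁ q)
    ; isEquivalence = record
      { refl = λ {p} → proj₂ p ; sym = 𝒲-sym ; trans = 𝒲-trans } }

  W₀ : Set
  W₀ = Setoid.Carrier W

  _≈W_ : W₀ → W₀ → Set
  _≈W_ = Setoid._≈_ W

  nW : W₀ → A.Carrier
  nW w = n (proj₁ w)

  private
    bw-self : {w : 𝕎} → 𝒲 w w → (b : B₀ (n w)) → 𝒲 (br w b) (br w b)
    bw-self (dsup α φ) b = φ b b (tr-id α b)

    bw-cong : {w : 𝕎} → 𝒲 w w → {b b' : B₀ (n w)} → F._≈_ (n w) b b' →
              𝒲 (br w b) (br w b')
    bw-cong {w} (dsup α φ) {b} {b'} p = φ b b' (F.trans (n w) (tr-id α b) p)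

  bW : (w : W₀) → Func (Fib (nW w)) W
  bW w = record
    { to = λ b → br (proj₁ w) b , bw-self (proj₂ w) b
    ; cong = bw-cong (proj₂ w) }

  ImS : W₀ → Setoid 0ℓ 0ℓ
  ImS w = record
    { Carrier = B₀ (nW w)
    ; _≈_ = λ s s' → to (bW w) s ≈W to (bW w) s'
    ; isEquivalence = record
      { refl = λ {s} → Setoid.refl W {to (bW w) s}
      ; sym = 𝒲-sym ; trans = 𝒲-trans } }

  private
    tr-congW : {w w' : 𝕎} (γ : 𝒲 w w') {s s' : B₀ (n w)} →
               𝒲 (br w s) (br w s') →
               𝒲 (br w' (to (tr (nlab γ)) s)) (br w' (to (tr (nlab γ)) s'))
    tr-congW {w} {w'} (dsup α φ) {s} {s'} p =
      𝒲-trans (𝒲-sym (φ s _ (F.refl (n w'))))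
        (𝒲-trans p (φ s' _ (F.refl (n w'))))

  ImS-tr : {w w' : W₀} → w ≈W w' → Func (ImS w) (ImS w')
  ImS-tr γ = record { to = to (tr (nlab γ)) ; cong = tr-congW γ }

  e : (w : W₀) → Func (Fib (nW w)) (ImS w)
  e w = record { to = λ b → b ; cong = cong (bW w) }

module Rec {A : Setoid 0ℓ 0ℓ} (B : SetoidFam A) (C : Setoid 0ℓ 0ℓ)
           (aC : Func (WTypes.PB B C) C) where
  open WTypes B
  private
    module C = Setoid C

  record CohFam (w : W₀) : Set where
    field
      fam : (s : B₀ (nW w)) → Func (ImS (to (bW w) s)) C
      coh : (s s' : B₀ (nW w)) (σ : to (bW w) s ≈W to (bW w) s') →
            fam s ≋ (fam s' ∘F ImS-tr {to (bW w) s} {to (bW w) s'} σ)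
  open CohFam public

  CohMaps : W₀ → Setoid 0ℓ 0ℓ
  CohMaps w = record
    { Carrier = CohFam w
    ; _≈_ = λ F G → (s : B₀ (nW w)) → fam F s ≋ fam G s
    ; isEquivalence = record
      { refl = λ s x → C.refl
      ; sym = λ p s x → C.sym (p s x)
      ; trans = λ p q s x → C.trans (p s x) (q s x) } }

  recst : (w : W₀) → Setoid.Carrier (CohMaps w) → Func (ImS w) C
  recst w F = record
    { to = λ s → to aC (nW (to (bW w) s) , (fam F s ∘F e (to (bW w) s)))
    ; cong = λ {s} {s'} σ → cong aC (nlab σ , coh F s s' σ) }

  data RecDef : (w : W₀) → Func (ImS w) C → Set where
    recdef : {w : W₀} {k : Func (ImS w) C}
             (F : Setoid.Carrier (CohMaps w)) →
             Setoid._≈_ (ImS w ⇒S C) k (recst w F) →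
             ((s : B₀ (nW w)) → RecDef (to (bW w) s) (fam F s)) →
             RecDef w k

module Submission where

-- Idea: first fold the whole setoid W into the algebra C,
--   foldW (sup a f) := a_C (a , s ↦ foldW (f s)),
-- by structural recursion on the underlying W-type, and prove, by structural
-- recursion on the proof of w ≈ w' in the inductive family 𝒲_B, that the
-- fold respects ≈_W.  Then recImS w := foldW ∘ b w is extensional on ImS w
-- precisely because the relation of ImS w is ≈_W on the subtrees.
--
-- The proof term recImSpf w : RecDef w (recImS w) is built by recursion on w:
-- its family of maps is s ↦ recImS (b w s), whose coherence is the statement
-- that recImS commutes with transport along w ≈ w' (recImS-transport); the
-- defining equation recImS w ≈ recst w F is the one-step unfolding of the
-- fold (foldW-unfold); and the subtree obligations are the recursive calls.

open import Defs
open import Level using (0ℓ)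
open import Relation.Binary.Bundles using (Setoid)
open import Function.Bundles using (Func)
open import Data.Product using (Σ; _,_)

module Construction {A : Setoid 0ℓ 0ℓ} (B : SetoidFam A) (C : Setoid 0ℓ 0ℓ)
                    (aC : Func (WTypes.PB B C) C) where
  open WTypes B
  open Rec B C aC
  open SetoidFam B
  open Func
  private
    module C = Setoid C

  branch-≈ : {w w' : W₀} (γ : w ≈W w') (x : B₀ (nW w)) →
             to (bW w) x ≈W to (bW w') (to (tr (nlab γ)) x)
  branch-≈ {_ , _} {sup a' f' , _} (dsup β ψ) x =
    ψ x (to (tr β) x) (Setoid.refl (Fib a'))

  -- Both recursions are written on the constructors (rather than via bW and
  -- branch-≈) so that they are visibly structural; matching both trees in
  -- foldW-cong also lets foldW unfold on each side to an a_C-value.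
  foldW : W₀ → C.Carrier
  foldW-cong : {w w' : W₀} → w ≈W w' → foldW w C.≈ foldW w'

  foldW w@(sup a f , dsup α φ) = to aC (a , record
    { to = λ s → foldW (f s , φ s s (tr-id α s))
    ; cong = λ r → foldW-cong (cong (bW w) r) })

  foldW-cong {sup a f , dsup α φ} {sup a' f' , dsup α' φ'} (dsup β ψ) =
    cong aC (β , λ x → foldW-cong (ψ x (to (tr β) x) (Setoid.refl (Fib a'))))

  -- recImS w : ImS w ⇒ C folds the s-th subtree; it is extensional since
  -- s ≈ s' in ImS w means exactly b w s ≈_W b w s'.
  recImS : (w : W₀) → Func (ImS w) C
  recImS w = record { to = λ s → foldW (to (bW w) s) ; cong = foldW-cong }

  recImS-transport : {w w' : W₀} (γ : w ≈W w') →
                     recImS w ≋ (recImS w' ∘F ImS-tr {w} {w'} γ)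
  recImS-transport {w} {w'} γ x = foldW-cong (branch-≈ {w} {w'} γ x)

  recImS-coh : (w : W₀) → CohFam w
  recImS-coh w = record
    { fam = λ s → recImS (to (bW w) s)
    ; coh = λ s s' σ → recImS-transport {to (bW w) s} {to (bW w) s'} σ }

  foldW-unfold : (w : W₀) → foldW w C.≈ to aC (nW w , recImS w ∘F e w)
  foldW-unfold (sup a f , dsup α φ) = C.refl

  recImS-pf : (w : W₀) → RecDef w (recImS w)
  recImS-pf w@(sup a f , dsup α φ) =
    recdef (recImS-coh w) (λ s → foldW-unfold (to (bW w) s))
           (λ s → recImS-pf (f s , φ s s (tr-id α s)))

proposition3p13 : (A : Setoid 0ℓ 0ℓ) (B : SetoidFam A) (C : Setoid 0ℓ 0ℓ)
    (aC : Func (WTypes.PB B C) C) (w : WTypes.W₀ B) →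
    Σ (Func (WTypes.ImS B w) C) (λ recImS → Rec.RecDef B C aC w recImS)
proposition3p13 A B C aC w = recImS w , recImS-pf w
  where open Construction B C aC
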